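{- Let $n\ge 2$. The maximum number of trees on a fixed $n$-element vertex set such that the union of any two distinct ones among them contains a triangle is $2^{n-1}-1$.
   Context: Trees are spanning trees on the given vertex set, regarded as edge sets. The union of two graphs on the same vertex set $V$ is the graph on $V$ whose edge set is the union of their edge sets. A triangle is a set of three pairwise adjacent vertices. -}

module Defs where

open import Data.Nat using (ℕ; _≤_; _^_; _∸_)
open import Data.Fin using (Fin)
open import Data.Bool using (Bool; true; false; _∨_)
open import Data.List using (List; []; _∷_; length)
open import Data.List.Relation.Unary.Linked using (Linked)
open import Data.List.Relation.Unary.Unique.Propositional using (Unique)
open import Data.Product using (Σ; Σ-syntax; ∃; _×_)
open import Relation.Binary.PropositionalEquality using (_≡_; _≢_)
open import Relation.Binary.Construct.Closure.ReflexiveTransitive using (Star)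
open import Relation.Nullary using (¬_)

Graph : ℕ → Set
Graph n = Fin n → Fin n → Bool

Adj : ∀ {n} → Graph n → Fin n → Fin n → Set
Adj G u v = G u v ≡ true

IsSimple : ∀ {n} → Graph n → Set
IsSimple G = (∀ u v → G u v ≡ G v u) × (∀ u → G u u ≡ false)

Connected : ∀ {n} → Graph n → Set
Connected G = ∀ u v → Star (Adj G) u v

lastOf : ∀ {n} → Fin n → List (Fin n) → Fin n
lastOf x [] = x
lastOf x (y ∷ ys) = lastOf y ys

Cycle : ∀ {n} → Graph n → Set
Cycle {n} G = Σ[ x ∈ Fin n ] Σ[ ys ∈ List (Fin n) ]
  (2 ≤ length ys) × Unique (x ∷ ys) × Linked (Adj G) (x ∷ ys) × Adj G (lastOf x ys) x

Acyclic : ∀ {n} → Graph n → Set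
Acyclic G = ¬ Cycle G

IsSpanningTree : ∀ {n} → Graph n → Set
IsSpanningTree G = IsSimple G × Connected G × Acyclic G

SameEdges : ∀ {n} → Graph n → Graph n → Set
SameEdges G H = ∀ u v → G u v ≡ H u v

_∪G_ : ∀ {n} → Graph n → Graph n → Graph n
(G ∪G H) u v = G u v ∨ H u v

HasTriangle : ∀ {n} → Graph n → Set
HasTriangle {n} G = Σ[ a ∈ Fin n ] Σ[ b ∈ Fin n ] Σ[ c ∈ Fin n ]
  Adj G a b × Adj G b c × Adj G a c

GoodFamily : ∀ n m → (Fin m → Graph n) → Set
GoodFamily n m T =
  (∀ i → IsSpanningTree (T i)) ×
  (∀ i j → i ≢ j → ¬ SameEdges (T i) (T j)) ×
  (∀ i j → i ≢ j → HasTriangle (T i ∪G T j))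

module Submission where

-- A spanning tree has no odd closed walk (a shortest one would be a cycle), so colouring each
-- vertex by the parity of a walk to it from vertex 0 is a proper 2-colouring with 0 coloured 0ℙ.
-- If two trees had the same such colouring it would properly colour their union, which then
-- could not contain a triangle; and the colouring is not constant, as 0 has a neighbour. Hence
-- a good family injects into the 2 ^ (n ∸ 1) ∸ 1 nonzero words over the vertices 1, …, n ∸ 1.
-- Conversely, each nonzero word w with w b ≡ true gives the double star joining 0 to the
-- vertices in w and b to the other nonzero vertices; if w′ y ≡ true but w y ≡ false, then
-- 0, b, y form a triangle in the union of the two stars.

open import Data.Bool using (Bool; true; false; not; _∧_; _∨_; if_then_else_)
open import Data.Bool.Properties using (∨-comm; ∨-identityʳ; ∨-zeroʳ; ¬-not)
import Data.Bool.Properties as Bool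
open import Data.Empty using (⊥; ⊥-elim)
open import Data.Fin using (Fin; zero; suc; toℕ; fromℕ<; funToFin; finToFun; combine; _≟_)
open import Data.Fin.Properties
  using (toℕ-injective; toℕ<n; toℕ-fromℕ<; toℕ-combine; finToFun-funToFin; funToFin-finToFin;
         injective⇒≤; ¬∀⟶∃¬; 2↔Bool)
open import Data.List using (List; []; _∷_; _++_; length)
open import Data.List.Membership.DecPropositional using (_∈?_)
open import Data.List.Membership.Propositional.Properties using (∈-∃++)
open import Data.List.Properties using (length-++)
open import Data.List.Relation.Unary.All using (All; _∷_)
open import Data.List.Relation.Unary.All.Properties using (¬Any⇒All¬)
open import Data.List.Relation.Unary.AllPairs using ([]; _∷_)
open import Data.List.Relation.Unary.Linked as Linked using (Linked; [-]; _∷_)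
open import Data.List.Relation.Unary.Unique.Propositional using (Unique)
open import Data.Nat using (ℕ; zero; suc; _+_; _*_; _^_; _∸_; _≤_; _<_; z≤n; s≤s; z<s; parity)
open import Data.Nat.Induction using (<-wellFounded)
open import Data.Nat.Properties
  using (suc-injective; +-comm; +-assoc; *-zeroʳ; m<m+n; m<n+m; m<n⇒n≢0; n≢0⇒n>0;
         ∸-monoˡ-<; ∸-cancelʳ-≡)
open import Data.Parity using (Parity; 0ℙ; 1ℙ; _⁻¹) renaming (_+_ to _⊕_)
open import Data.Parity.Properties using (+-homo-+; ⁻¹-involutive; ⁻¹-injective; p≢p⁻¹)
open import Data.Product using (Σ-syntax; ∃; ∃-syntax; _×_; _,_; proj₁; proj₂; map₂)
open import Data.Sum using (_⊎_; inj₁; inj₂)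
open import Function using (_∘_; Inverse)
open import Induction.WellFounded using (Acc; acc)
open import Relation.Binary using (Rel; DecidableEquality)
open import Relation.Binary.Construct.Closure.ReflexiveTransitive using (Star; ε; _◅_; _◅◅_; reverse)
open import Relation.Binary.PropositionalEquality
open import Relation.Nullary using (¬_; yes; no; contradiction; ⌊_⌋)
open import Relation.Nullary.Decidable using (decidable-stable)

open import Defs

-- Odd closed walks contain cycles

module _ {a ℓ} {A : Set a} {R : Rel A ℓ} where

  linked-++⁻ʳ : ∀ xs {ys} → Linked R (xs ++ ys) → Linked R ys
  linked-++⁻ʳ []       l = l
  linked-++⁻ʳ (x ∷ xs) l = linked-++⁻ʳ xs (Linked.tail l)

  linked-excise : ∀ x ys {v zs ws} →
    Linked R (x ∷ ys ++ v ∷ zs ++ v ∷ ws) → Linked R (x ∷ ys ++ v ∷ ws)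
  linked-excise x []       {v} {zs} (r ∷ l) = r ∷ linked-++⁻ʳ (v ∷ zs) l
  linked-excise x (y ∷ ys)          (r ∷ l) = r ∷ linked-excise y ys l

lastOf-++ : ∀ {n} (x : Fin n) ys z zs → lastOf x (ys ++ z ∷ zs) ≡ lastOf z zs
lastOf-++ x []       z zs = refl
lastOf-++ x (y ∷ ys) z zs = lastOf-++ y ys z zs

lastOf-All : ∀ {n p} {P : Fin n → Set p} x ys → All P (x ∷ ys) → P (lastOf x ys)
lastOf-All x []       (px ∷ _)  = px
lastOf-All x (y ∷ ys) (_ ∷ pys) = lastOf-All y ys pys

linked-++⁻ˡ : ∀ {n ℓ} {R : Rel (Fin n) ℓ} x ys {z zs} →
  Linked R (x ∷ ys ++ z ∷ zs) → Linked R (x ∷ ys) × R (lastOf x ys) z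
linked-++⁻ˡ x []       (r ∷ _) = [-] , r
linked-++⁻ˡ x (y ∷ ys) (r ∷ l) with linked-++⁻ˡ y ys l
... | l′ , r′ = r ∷ l′ , r′

HasDuplicate : ∀ {a} {A : Set a} → List A → Set a
HasDuplicate {A = A} xs =
  Σ[ as ∈ List A ] Σ[ v ∈ A ] Σ[ bs ∈ List A ] Σ[ cs ∈ List A ] xs ≡ as ++ v ∷ bs ++ v ∷ cs

unique⊎hasDuplicate : ∀ {a} {A : Set a} → DecidableEquality A →
  (xs : List A) → Unique xs ⊎ HasDuplicate xs
unique⊎hasDuplicate _≟_ []       = inj₁ []
unique⊎hasDuplicate _≟_ (x ∷ xs) with _∈?_ _≟_ x xs
... | yes x∈xs = let bs , cs , eq = ∈-∃++ x∈xs in inj₂ ([] , x , bs , cs , cong (x ∷_) eq)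
... | no  x∉xs with unique⊎hasDuplicate _≟_ xs
...   | inj₁ u = inj₁ (¬Any⇒All¬ xs x∉xs ∷ u)
...   | inj₂ (as , v , bs , cs , eq) = inj₂ (x ∷ as , v , bs , cs , cong (x ∷_) eq)

-- The walk x → y₁ → ⋯ → y_k → x; it has as many edges as the list has entries.
ClosedWalk : ∀ {n} → Graph n → List (Fin n) → Set
ClosedWalk G []       = ⊥
ClosedWalk G (x ∷ ys) = Linked (Adj G) (x ∷ ys) × Adj G (lastOf x ys) x

closedWalk-split : ∀ {n} {G : Graph n} as v bs cs →
  ClosedWalk G (as ++ v ∷ bs ++ v ∷ cs) → ClosedWalk G (v ∷ bs) × ClosedWalk G (as ++ v ∷ cs)
closedWalk-split {G = G} [] v bs cs (l , r) =
  linked-++⁻ˡ v bs l , linked-++⁻ʳ (v ∷ bs) l , subst (λ u → Adj G u v) (lastOf-++ v bs v cs) r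
closedWalk-split {G = G} (a ∷ as) v bs cs (l , r) =
  linked-++⁻ˡ v bs (linked-++⁻ʳ (a ∷ as) l) , linked-excise a as l , subst (λ u → Adj G u a) lastEq r
  where
  lastEq : lastOf a (as ++ v ∷ bs ++ v ∷ cs) ≡ lastOf a (as ++ v ∷ cs)
  lastEq = begin
    lastOf a (as ++ v ∷ bs ++ v ∷ cs) ≡⟨ lastOf-++ a as v (bs ++ v ∷ cs) ⟩
    lastOf v (bs ++ v ∷ cs)            ≡⟨ lastOf-++ v bs v cs ⟩
    lastOf v cs                        ≡⟨ lastOf-++ a as v cs ⟨
    lastOf a (as ++ v ∷ cs)            ∎
    where open ≡-Reasoning

length-split : ∀ {a} {A : Set a} (as : List A) v bs cs →
  length (as ++ v ∷ bs ++ v ∷ cs) ≡ length (v ∷ bs) + length (as ++ v ∷ cs)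
length-split as v bs cs = begin
  length (as ++ v ∷ bs ++ v ∷ cs)                ≡⟨ length-++ as ⟩
  length as + suc (length (bs ++ v ∷ cs))        ≡⟨ cong (λ k → length as + suc k) (length-++ bs) ⟩
  length as + (length (v ∷ bs) + length (v ∷ cs)) ≡⟨ +-assoc (length as) _ _ ⟨
  length as + length (v ∷ bs) + length (v ∷ cs)   ≡⟨ cong (_+ length (v ∷ cs)) (+-comm (length as) _) ⟩
  length (v ∷ bs) + length as + length (v ∷ cs)   ≡⟨ +-assoc (length (v ∷ bs)) _ _ ⟩
  length (v ∷ bs) + (length as + length (v ∷ cs)) ≡⟨ cong (length (v ∷ bs) +_) (length-++ as) ⟨
  length (v ∷ bs) + length (as ++ v ∷ cs)         ∎
  where open ≡-Reasoning

0<length-++-∷ : ∀ {a} {A : Set a} (xs : List A) {y ys} → 0 < length (xs ++ y ∷ ys)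
0<length-++-∷ []      = z<s
0<length-++-∷ (_ ∷ _) = z<s

parity-odd-+ : ∀ m n → parity (m + n) ≡ 1ℙ → parity m ≡ 1ℙ ⊎ parity n ≡ 1ℙ
parity-odd-+ m n odd rewrite +-homo-+ m n with parity m
... | 0ℙ = inj₂ odd
... | 1ℙ = inj₁ refl

uniqueOddClosedWalk⇒cycle : ∀ {n} {G : Graph n} → (∀ u → G u u ≡ false) →
  ∀ xs → Unique xs → ClosedWalk G xs → parity (length xs) ≡ 1ℙ → Cycle G
uniqueOddClosedWalk⇒cycle irreflexive (x ∷ []) _ (_ , loop) _ with trans (sym loop) (irreflexive x)
... | ()
uniqueOddClosedWalk⇒cycle irreflexive (x ∷ ys@(_ ∷ _ ∷ _)) u (l , r) _ =
  x , ys , s≤s (s≤s z≤n) , u , l , r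

-- A repeated vertex splits a closed walk into two shorter closed walks; if it is odd, so is one of them.
hasDuplicate⇒shorterOddClosedWalk : ∀ {n} {G : Graph n} xs → HasDuplicate xs → ClosedWalk G xs →
  parity (length xs) ≡ 1ℙ →
  Σ[ ys ∈ List (Fin n) ] length ys < length xs × ClosedWalk G ys × parity (length ys) ≡ 1ℙ
hasDuplicate⇒shorterOddClosedWalk _ (as , v , bs , cs , refl) walk odd
  rewrite length-split as v bs cs
  with closedWalk-split as v bs cs walk | parity-odd-+ (length (v ∷ bs)) _ odd
... | loop , _ | inj₁ oddLoop = v ∷ bs , m<m+n _ (0<length-++-∷ as) , loop , oddLoop
... | _ , rest | inj₂ oddRest = as ++ v ∷ cs , m<n+m _ z<s , rest , oddRest

oddClosedWalk⇒cycle : ∀ {n} {G : Graph n} → (∀ u → G u u ≡ false) →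
  ∀ xs → ClosedWalk G xs → parity (length xs) ≡ 1ℙ → Cycle G
oddClosedWalk⇒cycle {G = G} irreflexive xs = go xs (<-wellFounded (length xs))
  where
  go : ∀ xs → Acc _<_ (length xs) → ClosedWalk G xs → parity (length xs) ≡ 1ℙ → Cycle G
  go xs (acc rec) walk odd with unique⊎hasDuplicate _≟_ xs
  ... | inj₁ unique = uniqueOddClosedWalk⇒cycle irreflexive xs unique walk odd
  ... | inj₂ dup with hasDuplicate⇒shorterOddClosedWalk xs dup walk odd
  ...   | ys , shorter , walk′ , odd′ = go ys (rec shorter) walk′ odd′

-- Spanning trees are bipartite

module _ {a ℓ} {A : Set a} {R : Rel A ℓ} where

  walkLength : ∀ {x y} → Star R x y → ℕ
  walkLength ε       = 0
  walkLength (_ ◅ s) = suc (walkLength s)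

  walkLength-◅◅ : ∀ {x y z} (s : Star R x y) (t : Star R y z) →
    walkLength (s ◅◅ t) ≡ walkLength s + walkLength t
  walkLength-◅◅ ε       t = refl
  walkLength-◅◅ (_ ◅ s) t = cong suc (walkLength-◅◅ s t)

  star-firstStep : ∀ {x y} → Star R x y → x ≢ y → ∃ (R x)
  star-firstStep ε       x≢x = contradiction refl x≢x
  star-firstStep (r ◅ _) _   = _ , r

star⇒linked : ∀ {n ℓ} {R : Rel (Fin n) ℓ} {x y} (s : Star R x y) →
  Σ[ ws ∈ List (Fin n) ] Linked R (x ∷ ws) × lastOf x ws ≡ y × length ws ≡ walkLength s
star⇒linked ε = [] , [-] , refl , refl
star⇒linked (r ◅ s) with star⇒linked s
... | ws , l , last≡ , length≡ = _ ∷ ws , r ∷ l , last≡ , cong suc length≡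

module _ {n} {G : Graph n} (irreflexive : ∀ u → G u u ≡ false) where

  oddClosedStar⇒cycle : ∀ {x} (s : Star (Adj G) x x) → parity (walkLength s) ≡ 1ℙ → Cycle G
  oddClosedStar⇒cycle (_◅_ {j = z} r s) odd with star⇒linked s
  ... | ws , l , last≡ , length≡ =
    oddClosedWalk⇒cycle irreflexive (z ∷ ws)
      (l , subst (λ w → Adj G w z) (sym last≡) r)
      (subst (λ k → parity (suc k) ≡ 1ℙ) (sym length≡) odd)

  acyclic⇒closedWalk-even : Acyclic G → ∀ {x} (s : Star (Adj G) x x) → parity (walkLength s) ≡ 0ℙ
  acyclic⇒closedWalk-even acyclic s with parity (walkLength s) in eq
  ... | 0ℙ = refl
  ... | 1ℙ = ⊥-elim (acyclic (oddClosedStar⇒cycle s eq))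

ProperColouring : ∀ {n} → Graph n → (Fin n → Parity) → Set
ProperColouring G c = ∀ {u v} → Adj G u v → c u ≡ c v ⁻¹

⊕≡0ℙ⇒≡ : ∀ p q → p ⊕ q ≡ 0ℙ → p ≡ q
⊕≡0ℙ⇒≡ 0ℙ 0ℙ _ = refl
⊕≡0ℙ⇒≡ 1ℙ 1ℙ _ = refl

spanningTree⇒properColouring : ∀ {n} {G : Graph n} → IsSpanningTree G → (root : Fin n) →
  Σ[ c ∈ (Fin n → Parity) ] ProperColouring G c × c root ≡ 0ℙ
spanningTree⇒properColouring {n} {G} ((_ , irreflexive) , connected , acyclic) root =
  colour , proper , even (connected root root)
  where
  even : ∀ {x} (s : Star (Adj G) x x) → parity (walkLength s) ≡ 0ℙ
  even = acyclic⇒closedWalk-even irreflexive acyclic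

  colour : Fin n → Parity
  colour v = parity (walkLength (connected root v))

  parity-◅◅ : ∀ {x y z} (s : Star (Adj G) x y) (t : Star (Adj G) y z) →
    parity (walkLength (s ◅◅ t)) ≡ parity (walkLength s) ⊕ parity (walkLength t)
  parity-◅◅ s t = trans (cong parity (walkLength-◅◅ s t)) (+-homo-+ (walkLength s) (walkLength t))

  returnColour : ∀ v → parity (walkLength (connected v root)) ≡ colour v
  returnColour v = sym (⊕≡0ℙ⇒≡ _ _
    (trans (sym (parity-◅◅ (connected root v) (connected v root)))
           (even (connected root v ◅◅ connected v root))))

  proper : ProperColouring G colour
  proper {u} {v} e = ⊕≡0ℙ⇒≡ (colour u) (colour v ⁻¹) (begin
    colour u ⊕ colour v ⁻¹                              ≡⟨ cong (λ p → colour u ⊕ p ⁻¹) (returnColour v) ⟨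
    colour u ⊕ parity (walkLength back) ⁻¹               ≡⟨ cong (colour u ⊕_) (+-homo-+ 1 (walkLength back)) ⟨
    colour u ⊕ parity (suc (walkLength back))            ≡⟨ parity-◅◅ (connected root u) (e ◅ back) ⟨
    parity (walkLength (connected root u ◅◅ e ◅ back))   ≡⟨ even (connected root u ◅◅ e ◅ back) ⟩
    0ℙ                                                   ∎)
    where
    open ≡-Reasoning
    back : Star (Adj G) v root
    back = connected v root

properColouring-∪G : ∀ {n} {G H : Graph n} {c} →
  ProperColouring G c → ProperColouring H c → ProperColouring (G ∪G H) c
properColouring-∪G {G = G} properG properH {u} {v} e with G u v in eq
... | true  = properG eq
... | false = properH e

properColouring⇒triangleFree : ∀ {n} {G : Graph n} {c} → ProperColouring G c → ¬ HasTriangle G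
properColouring⇒triangleFree {c = c} proper (x , y , z , xy , yz , xz) =
  p≢p⁻¹ (c y) (trans (proper yz) (cong _⁻¹ (sym cy≡cz)))
  where
  cy≡cz : c y ≡ c z
  cy≡cz = ⁻¹-injective (trans (sym (proper xy)) (proper xz))

-- Numbering the nonzero binary words

open Inverse 2↔Bool using () renaming (to to bitToBool; from to boolToBit;
  strictlyInverseˡ to bitToBool-boolToBit; strictlyInverseʳ to boolToBit-bitToBool)

funToFin-cong : ∀ {k m} {f g : Fin k → Fin m} → (∀ j → f j ≡ g j) → funToFin f ≡ funToFin g
funToFin-cong {zero}  _   = refl
funToFin-cong {suc k} f≗g = cong₂ combine (f≗g zero) (funToFin-cong (f≗g ∘ suc))

toℕ-funToFin-zero : ∀ k {m} → toℕ (funToFin {k} {suc m} (λ _ → zero)) ≡ 0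
toℕ-funToFin-zero zero          = refl
toℕ-funToFin-zero (suc k) {m} = begin
  toℕ (funToFin {suc k} {suc m} (λ _ → zero))  ≡⟨ toℕ-combine {suc m} {suc m ^ k} zero rest ⟩
  suc m ^ k * 0 + toℕ rest                     ≡⟨ cong (_+ toℕ rest) (*-zeroʳ (suc m ^ k)) ⟩
  toℕ rest                                     ≡⟨ toℕ-funToFin-zero k ⟩
  0                                            ∎
  where
  open ≡-Reasoning
  rest : Fin (suc m ^ k)
  rest = funToFin {k} {suc m} (λ _ → zero)

encode : ∀ {k} → (Fin k → Bool) → Fin (2 ^ k)
encode w = funToFin (boolToBit ∘ w)

decode : ∀ k → Fin (2 ^ k) → Fin k → Bool
decode k x = bitToBool ∘ finToFun {n = k} x

decode-encode : ∀ {k} (w : Fin k → Bool) j → decode k (encode w) j ≡ w j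
decode-encode w j = trans (cong bitToBool (finToFun-funToFin (boolToBit ∘ w) j)) (bitToBool-boolToBit (w j))

encode-cong : ∀ {k} {w w′ : Fin k → Bool} → (∀ j → w j ≡ w′ j) → encode w ≡ encode w′
encode-cong w≗w′ = funToFin-cong (cong boolToBit ∘ w≗w′)

encode-decode : ∀ k (x : Fin (2 ^ k)) → encode (decode k x) ≡ x
encode-decode k x = trans (funToFin-cong (boolToBit-bitToBool ∘ finToFun {n = k} x)) (funToFin-finToFin {k} x)

decode-injective : ∀ k {x y : Fin (2 ^ k)} → (∀ j → decode k x j ≡ decode k y j) → x ≡ y
decode-injective k {x} {y} x≈y = trans (sym (encode-decode k x)) (trans (encode-cong x≈y) (encode-decode k y))

encode-injective : ∀ {k} {w w′ : Fin k → Bool} → encode w ≡ encode w′ → ∀ j → w j ≡ w′ j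
encode-injective {k} {w} {w′} eq j =
  trans (sym (decode-encode w j)) (trans (cong (λ x → decode k x j) eq) (decode-encode w′ j))

encode-positive : ∀ {k} (w : Fin k → Bool) → ∃[ j ] w j ≡ true → 0 < toℕ (encode w)
encode-positive {k} w (j , wj) = n≢0⇒n>0 λ encode≡0 →
  let w≗false = encode-injective (toℕ-injective (trans encode≡0 (sym (toℕ-funToFin-zero k)))) in
  contradiction (trans (sym wj) (w≗false j)) λ ()

decode-positive : ∀ k (x : Fin (2 ^ k)) → 0 < toℕ x → ∃[ j ] decode k x j ≡ true
decode-positive k x 0<x =
  map₂ ¬-not (¬∀⟶∃¬ k (λ j → decode k x j ≡ false) (λ j → decode k x j Bool.≟ false) notAllFalse)
  where
  notAllFalse : ¬ (∀ j → decode k x j ≡ false)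
  notAllFalse allFalse = m<n⇒n≢0 0<x (begin
    toℕ x                          ≡⟨ cong toℕ (encode-decode k x) ⟨
    toℕ (encode (decode k x))      ≡⟨ cong toℕ (encode-cong allFalse) ⟩
    toℕ (encode {k} (λ _ → false)) ≡⟨ toℕ-funToFin-zero k ⟩
    0                              ∎)
    where open ≡-Reasoning

-- The nonzero words of length k are numbered 0, …, 2 ^ k ∸ 2 by their value minus one.
nonzeroCode : ∀ {k} (w : Fin k → Bool) → ∃[ j ] w j ≡ true → Fin (2 ^ k ∸ 1)
nonzeroCode w nz = fromℕ< (∸-monoˡ-< (toℕ<n (encode w)) (encode-positive w nz))

nonzeroCode-injective : ∀ {k} {w w′ : Fin k → Bool} nz nz′ →
  nonzeroCode w nz ≡ nonzeroCode w′ nz′ → ∀ j → w j ≡ w′ j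
nonzeroCode-injective {w = w} {w′} nz nz′ eq = encode-injective (toℕ-injective
  (∸-cancelʳ-≡ (encode-positive w nz) (encode-positive w′ nz′)
    (trans (sym (toℕ-fromℕ< _)) (trans (cong toℕ eq) (toℕ-fromℕ< _)))))

m<n∸1⇒1+m<n : ∀ {m n} → m < n ∸ 1 → suc m < n
m<n∸1⇒1+m<n {n = suc _} m<n = s≤s m<n

nonzeroWord : ∀ k → Fin (2 ^ k ∸ 1) → Fin k → Bool
nonzeroWord k i = decode k (fromℕ< (m<n∸1⇒1+m<n (toℕ<n i)))

nonzeroWord-nonzero : ∀ k i → ∃[ j ] nonzeroWord k i j ≡ true
nonzeroWord-nonzero k i = decode-positive k _ (subst (0 <_) (sym (toℕ-fromℕ< _)) z<s)

nonzeroWord-injective : ∀ k {i i′} → (∀ j → nonzeroWord k i j ≡ nonzeroWord k i′ j) → i ≡ i′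
nonzeroWord-injective k eq = toℕ-injective (suc-injective
  (trans (sym (toℕ-fromℕ< _)) (trans (cong toℕ (decode-injective k eq)) (toℕ-fromℕ< _))))

-- Double stars

Branching : ∀ {n} → Graph n → Fin n → Set
Branching {n} G u = Σ[ v ∈ Fin n ] Σ[ v′ ∈ Fin n ] v ≢ v′ × Adj G u v × Adj G u v′

cycle⇒threeBranching : ∀ {n} {G : Graph n} → (∀ u v → G u v ≡ G v u) → Cycle G →
  Σ[ x ∈ Fin n ] Σ[ y ∈ Fin n ] Σ[ z ∈ Fin n ] x ≢ y × x ≢ z × y ≢ z ×
    Branching G x × Branching G y × Branching G z
cycle⇒threeBranching _ (_ , _ ∷ [] , s≤s () , _)
cycle⇒threeBranching {G = G} symmetric
  (x , y ∷ z ∷ rest , _ , ((x≢y ∷ x≢z ∷ _) ∷ (y≢z ∷ y≢rest) ∷ _) , xy ∷ yz ∷ zrest , close) =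
  x , y , z , x≢y , x≢z , y≢z ,
  (y , lastOf z rest , lastOf-All {P = λ u → y ≢ u} z rest (y≢z ∷ y≢rest) , xy , flip close) ,
  (x , z , x≢z , flip xy , yz) ,
  branchingZ rest zrest y≢rest close
  where
  flip : ∀ {u v} → Adj G u v → Adj G v u
  flip {u} {v} e = trans (symmetric v u) e

  branchingZ : ∀ rest → Linked (Adj G) (z ∷ rest) → All (λ u → y ≢ u) rest →
    Adj G (lastOf z rest) x → Branching G z
  branchingZ []      _        _         zx = y , x , (λ y≡x → x≢y (sym y≡x)) , flip yz , zx
  branchingZ (w ∷ _) (zw ∷ _) (y≢w ∷ _) _  = y , w , y≢w , flip yz , zw

noThreeDistinctInPair : ∀ {a} {A : Set a} {p q x y z : A} →
  x ≡ p ⊎ x ≡ q → y ≡ p ⊎ y ≡ q → z ≡ p ⊎ z ≡ q → x ≢ y → x ≢ z → y ≢ z → ⊥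
noThreeDistinctInPair (inj₁ refl) (inj₁ refl) _           x≢y _   _   = x≢y refl
noThreeDistinctInPair (inj₂ refl) (inj₂ refl) _           x≢y _   _   = x≢y refl
noThreeDistinctInPair (inj₁ refl) _           (inj₁ refl) _   x≢z _   = x≢z refl
noThreeDistinctInPair (inj₂ refl) _           (inj₂ refl) _   x≢z _   = x≢z refl
noThreeDistinctInPair _           (inj₁ refl) (inj₁ refl) _   _   y≢z = y≢z refl
noThreeDistinctInPair _           (inj₂ refl) (inj₂ refl) _   _   y≢z = y≢z refl

-- The double star on 0, 1, …, K: vertex 0 is joined to each suc v with w v ≡ true,
-- and the centre suc b to each suc v with w v ≡ false.
module DoubleStar {K} (w : Fin K → Bool) (b : Fin K) (wb : w b ≡ true) where

  arc : Fin (suc K) → Fin (suc K) → Bool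
  arc zero    (suc v) = w v
  arc (suc u) (suc v) = ⌊ u ≟ b ⌋ ∧ not (w v)
  arc _       zero    = false

  graph : Graph (suc K)
  graph u v = arc u v ∨ arc v u

  graph-root : ∀ v → graph zero (suc v) ≡ w v
  graph-root v = ∨-identityʳ (w v)

  graph-centre : ∀ v → w v ≡ false → Adj graph (suc b) (suc v)
  graph-centre v wv with b ≟ b
  ... | yes _   rewrite wv = refl
  ... | no  b≢b = contradiction refl b≢b

  graph-symmetric : ∀ u v → graph u v ≡ graph v u
  graph-symmetric u v = ∨-comm (arc u v) (arc v u)

  arc-irreflexive : ∀ u → arc u u ≡ false
  arc-irreflexive zero    = refl
  arc-irreflexive (suc u) with u ≟ b
  ... | yes refl rewrite wb = refl
  ... | no  _    = refl

  graph-irreflexive : ∀ u → graph u u ≡ false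
  graph-irreflexive u rewrite arc-irreflexive u = refl

  pathFromRoot : ∀ v → Star (Adj graph) zero v
  pathFromRoot zero    = ε
  pathFromRoot (suc v) with w v in wv
  ... | true  = trans (graph-root v) wv ◅ ε
  ... | false = _◅_ {j = suc b} (trans (graph-root b) wb) (graph-centre v wv ◅ ε)

  connected : Connected graph
  connected u v =
    reverse (λ {x} {y} e → trans (graph-symmetric y x) e) (pathFromRoot u) ◅◅ pathFromRoot v

  parent : Fin K → Fin (suc K)
  parent u = if w u then zero else suc b

  leaf-adj : ∀ {u v} → u ≢ b → Adj graph (suc u) v → v ≡ parent u
  leaf-adj {u} {zero}  _   e rewrite e = refl
  leaf-adj {u} {suc v} u≢b e with u ≟ b | v ≟ b
  ... | yes u≡b | _     = contradiction u≡b u≢b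
  ... | no _    | yes refl with w u
  ...   | false = refl
  leaf-adj {u} {suc v} u≢b () | no _ | no _

  branching⇒rootOrCentre : ∀ {u} → Branching graph u → u ≡ zero ⊎ u ≡ suc b
  branching⇒rootOrCentre {zero}  _ = inj₁ refl
  branching⇒rootOrCentre {suc u} (v , v′ , v≢v′ , e , e′) with u ≟ b
  ... | yes u≡b = inj₂ (cong suc u≡b)
  ... | no  u≢b = contradiction (trans (leaf-adj u≢b e) (sym (leaf-adj u≢b e′))) v≢v′

  -- A cycle has three distinct vertices of degree at least two, but only 0 and suc b have that.
  acyclic : Acyclic graph
  acyclic cycle with cycle⇒threeBranching graph-symmetric cycle
  ... | _ , _ , _ , x≢y , x≢z , y≢z , bx , by , bz =
    noThreeDistinctInPair (branching⇒rootOrCentre bx) (branching⇒rootOrCentre by)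
                          (branching⇒rootOrCentre bz) x≢y x≢z y≢z

  isSpanningTree : IsSpanningTree graph
  isSpanningTree = (graph-symmetric , graph-irreflexive) , connected , acyclic

doubleStar : ∀ {K} (w : Fin K → Bool) → ∃[ b ] w b ≡ true → Graph (suc K)
doubleStar w (b , wb) = DoubleStar.graph w b wb

∨-introˡ : ∀ {a b} → a ≡ true → a ∨ b ≡ true
∨-introˡ refl = refl

∨-introʳ : ∀ {a b} → b ≡ true → a ∨ b ≡ true
∨-introʳ {a} refl = ∨-zeroʳ a

twoEdges+oneEdge⇒triangle : ∀ {n} (G H : Graph n) {a b c} → Adj G a b → Adj G b c → Adj H a c →
  HasTriangle (G ∪G H) × HasTriangle (H ∪G G)
twoEdges+oneEdge⇒triangle G H {a} {b} {c} ab bc ac =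
  (a , b , c , ∨-introˡ ab , ∨-introˡ bc , ∨-introʳ {G a c} ac) ,
  (a , b , c , ∨-introʳ {H a b} ab , ∨-introʳ {H b c} bc , ∨-introˡ ac)

doubleStars-triangle : ∀ {K} (w w′ : Fin K → Bool) nz nz′ {y} → w y ≢ w′ y →
  HasTriangle (doubleStar w nz ∪G doubleStar w′ nz′)
doubleStars-triangle w w′ (b , wb) (b′ , w′b′) {y} w≢w′ with w y in wy | w′ y in w′y
... | false | false = contradiction refl w≢w′
... | true  | true  = contradiction refl w≢w′
... | false | true  = proj₁ (twoEdges+oneEdge⇒triangle S.graph S′.graph {zero} {suc b} {suc y}
  (trans (S.graph-root b) wb) (S.graph-centre y wy) (trans (S′.graph-root y) w′y))
  where
  module S = DoubleStar w b wb
  module S′ = DoubleStar w′ b′ w′b′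
... | true  | false = proj₂ (twoEdges+oneEdge⇒triangle S′.graph S.graph {zero} {suc b′} {suc y}
  (trans (S′.graph-root b′) w′b′) (S′.graph-centre y w′y) (trans (S.graph-root y) wy))
  where
  module S = DoubleStar w b wb
  module S′ = DoubleStar w′ b′ w′b′

lowerBound : ∀ K → Σ[ T ∈ (Fin (2 ^ K ∸ 1) → Graph (suc K)) ] GoodFamily (suc K) (2 ^ K ∸ 1) T
lowerBound K = T , trees , distinct , triangles
  where
  word : Fin (2 ^ K ∸ 1) → Fin K → Bool
  word = nonzeroWord K

  nonzero : ∀ i → ∃[ v ] word i v ≡ true
  nonzero = nonzeroWord-nonzero K

  T : Fin (2 ^ K ∸ 1) → Graph (suc K)
  T i = doubleStar (word i) (nonzero i)

  trees : ∀ i → IsSpanningTree (T i)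
  trees i = DoubleStar.isSpanningTree (word i) _ (proj₂ (nonzero i))

  rootRow : ∀ i v → T i zero (suc v) ≡ word i v
  rootRow i v = DoubleStar.graph-root (word i) _ (proj₂ (nonzero i)) v

  distinct : ∀ i j → i ≢ j → ¬ SameEdges (T i) (T j)
  distinct i j i≢j same = i≢j (nonzeroWord-injective K λ v →
    trans (sym (rootRow i v)) (trans (same zero (suc v)) (rootRow j v)))

  triangles : ∀ i j → i ≢ j → HasTriangle (T i ∪G T j)
  triangles i j i≢j with ¬∀⟶∃¬ K (λ v → word i v ≡ word j v) (λ v → word i v Bool.≟ word j v)
                                 (i≢j ∘ nonzeroWord-injective K)
  ... | _ , differ = doubleStars-triangle (word i) (word j) (nonzero i) (nonzero j) differ

-- The upper bound

properColouring-cong : ∀ {n} {G : Graph n} {c c′} → ProperColouring G c → (∀ v → c v ≡ c′ v) →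
  ProperColouring G c′
properColouring-cong proper c≗c′ {u} {v} e = trans (sym (c≗c′ u)) (trans (proper e) (cong _⁻¹ (c≗c′ v)))

properColouring-opposite : ∀ {n} {G : Graph n} {c x y} →
  ProperColouring G c → Star (Adj G) x y → x ≢ y → ∃[ u ] c u ≡ c x ⁻¹
properColouring-opposite {c = c} proper walk x≢y with star-firstStep walk x≢y
... | u , e = u , trans (sym (⁻¹-involutive (c u))) (cong _⁻¹ (sym (proper e)))

isOdd : Parity → Bool
isOdd 0ℙ = false
isOdd 1ℙ = true

isOdd-injective : ∀ {p q} → isOdd p ≡ isOdd q → p ≡ q
isOdd-injective {0ℙ} {0ℙ} _ = refl
isOdd-injective {1ℙ} {1ℙ} _ = refl

colourWord : ∀ {K} → (Fin (suc K) → Parity) → Fin K → Bool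
colourWord c v = isOdd (c (suc v))

colourWord-injective : ∀ {K} {c c′ : Fin (suc K) → Parity} → c zero ≡ c′ zero →
  (∀ v → colourWord c v ≡ colourWord c′ v) → ∀ v → c v ≡ c′ v
colourWord-injective c₀≡c′₀ _       zero    = c₀≡c′₀
colourWord-injective _       w≗w′ (suc v) = isOdd-injective (w≗w′ v)

colourWord-nonzero : ∀ {k} {G : Graph (suc (suc k))} {c} → Connected G → ProperColouring G c →
  c zero ≡ 0ℙ → ∃[ v ] colourWord c v ≡ true
colourWord-nonzero {c = c} connected proper c₀≡0
  with properColouring-opposite proper (connected zero (suc zero)) (λ ())
... | zero  , opposite = contradiction opposite (p≢p⁻¹ (c zero))
... | suc v , opposite = v , cong isOdd (trans opposite (cong _⁻¹ c₀≡0))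

upperBound : ∀ k m (T : Fin m → Graph (suc (suc k))) → GoodFamily (suc (suc k)) m T → m ≤ 2 ^ suc k ∸ 1
upperBound k m T (trees , _ , triangles) = injective⇒≤ code-injective
  where
  colouring : ∀ i → Σ[ c ∈ (Fin (suc (suc k)) → Parity) ] ProperColouring (T i) c × c zero ≡ 0ℙ
  colouring i = spanningTree⇒properColouring (trees i) zero

  colour : Fin m → Fin (suc (suc k)) → Parity
  colour i = proj₁ (colouring i)

  proper : ∀ i → ProperColouring (T i) (colour i)
  proper i = proj₁ (proj₂ (colouring i))

  rootColour : ∀ i → colour i zero ≡ 0ℙ
  rootColour i = proj₂ (proj₂ (colouring i))

  nonzero : ∀ i → ∃[ v ] colourWord (colour i) v ≡ true
  nonzero i = colourWord-nonzero (proj₁ (proj₂ (trees i))) (proper i) (rootColour i)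

  code : Fin m → Fin (2 ^ suc k ∸ 1)
  code i = nonzeroCode (colourWord (colour i)) (nonzero i)

  code-injective : ∀ {i j} → code i ≡ code j → i ≡ j
  code-injective {i} {j} eq = decidable-stable (i ≟ j) λ i≢j →
    properColouring⇒triangleFree
      (properColouring-∪G {G = T i} {T j} (proper i) (properColouring-cong (proper j) sameColour))
      (triangles i j i≢j)
    where
    sameColour : ∀ v → colour j v ≡ colour i v
    sameColour = colourWord-injective (trans (rootColour j) (sym (rootColour i)))
                                      (λ v → sym (nonzeroCode-injective (nonzero i) (nonzero j) eq v))

claim4p2 : (n : ℕ) → 2 ≤ n →
    (Σ[ T ∈ (Fin (2 ^ (n ∸ 1) ∸ 1) → Graph n) ] GoodFamily n (2 ^ (n ∸ 1) ∸ 1) T)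
    × ((m : ℕ) (T : Fin m → Graph n) → GoodFamily n m T → m ≤ 2 ^ (n ∸ 1) ∸ 1)
claim4p2 (suc (suc k)) _ = lowerBound (suc k) , upperBound k
claim4p2 (suc zero) (s≤s ())
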